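{- Let $\mathcal A^\circ_n(\delta_k;1342)$ be the set of cyclic permutations $\pi\in\mathfrak S_n$ whose one-line notation avoids $\delta_k=k(k-1)\cdots21$ and such that every cyclic rotation of the cycle form $C(\pi)$ avoids $1342$, and let $b^\circ_{n,k}(1342)$ be the number of $\pi\in\mathcal A^\circ_n(\delta_k;1342)$ with $\pi_1=n$. Then for $n\ge 3$ and $k\ge 4$, the number of permutations $\pi\in\mathcal A^\circ_n(\delta_k;1342)$ with $\pi_1=n-1$ and $\pi_n=1$ equals $b^\circ_{n-1,k-1}(1342)$.
   Context: A permutation $\pi\in\mathfrak S_n$ is cyclic if it is a single $n$-cycle. Its cycle form is $C(\pi)=(1,c_2,\dots,c_n)$ with $c_2=\pi(1)$, $c_{i+1}=\pi(c_i)$. The cyclic rotations of $C(\pi)$ are the sequences $c_i,\dots,c_n,c_1,\dots,c_{i-1}$ (with $c_1=1$). A sequence avoids $\sigma\in\mathfrak S_m$ if no length-$m$ subsequence is order-isomorphic to $\sigma$. One-line notation: $\pi_1\cdots\pi_n$ with $\pi_i=\pi(i)$. -}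

module Defs where

-- A permutation π ∈ 𝔖_n is represented
-- by its one-line notation π₁⋯πₙ, a list of length n with entries in {1,…,n}
-- that are pairwise distinct.

open import Data.Bool using (Bool; true; false; _∧_; _∨_; not; if_then_else_)
open import Data.Nat using (ℕ; zero; suc; _+_; _∸_; _≡ᵇ_; _<ᵇ_)
open import Data.List using (List; []; _∷_; length; map; concatMap; filterᵇ; upTo; applyUpTo; _++_; reverse)
open import Data.Bool.ListAction using (all; any)
open import Data.Maybe using (Maybe; just; nothing)

-- x-th entry (1-indexed) of a list, 0 if out of range
at : List ℕ → ℕ → ℕ
at []       _             = 0
at (x ∷ xs) zero          = 0
at (x ∷ xs) (suc zero)    = x
at (x ∷ xs) (suc (suc i)) = at xs (suc i)

words : ℕ → ℕ → List (List ℕ)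
words zero    m = [] ∷ []
words (suc l) m = concatMap (λ a → map (a ∷_) (words l m)) (applyUpTo suc m)

distinct : List ℕ → Bool
distinct []       = true
distinct (x ∷ xs) = not (any (x ≡ᵇ_) xs) ∧ distinct xs

perms : ℕ → List (List ℕ)
perms n = filterᵇ distinct (words n n)

iter : List ℕ → ℕ → ℕ → ℕ
iter π zero    x = x
iter π (suc i) x = at π (iter π i x)

cyclic : List ℕ → Bool
cyclic π = all (λ i → not (iter π (suc i) 1 ≡ᵇ 1)) (upTo (length π ∸ 1))

cycleForm : List ℕ → List ℕ
cycleForm π = applyUpTo (λ i → iter π i 1) (length π)

rotate : ℕ → List ℕ → List ℕ
rotate zero    xs       = xs
rotate (suc i) []       = []
rotate (suc i) (x ∷ xs) = rotate i (xs ++ (x ∷ []))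

rotations : List ℕ → List (List ℕ)
rotations xs = applyUpTo (λ i → rotate i xs) (length xs)

subseqs : ℕ → List ℕ → List (List ℕ)
subseqs zero    _        = [] ∷ []
subseqs (suc m) []       = []
subseqs (suc m) (x ∷ xs) = map (x ∷_) (subseqs m xs) ++ subseqs (suc m) xs

orderIso : List ℕ → List ℕ → Bool
orderIso s σ = (length s ≡ᵇ length σ) ∧
  all (λ i → all (λ j → eqB (at s i <ᵇ at s j) (at σ i <ᵇ at σ j))
                 (applyUpTo suc (length σ)))
      (applyUpTo suc (length σ))
  where
  eqB : Bool → Bool → Bool
  eqB true  b = b
  eqB false b = not b

contains : List ℕ → List ℕ → Bool
contains σ s = any (λ t → orderIso t σ) (subseqs (length σ) s)

avoids : List ℕ → List ℕ → Bool
avoids σ s = not (contains σ s)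

δ : ℕ → List ℕ
δ k = reverse (applyUpTo suc k)

p1342 : List ℕ
p1342 = 1 ∷ 3 ∷ 4 ∷ 2 ∷ []

inA : ℕ → List ℕ → Bool
inA k π = cyclic π ∧ avoids (δ k) π ∧ all (avoids p1342) (rotations (cycleForm π))

first lastE : List ℕ → ℕ
first π = at π 1
lastE π = at π (length π)

b° : ℕ → ℕ → ℕ
b° n k = length (filterᵇ (λ π → inA k π ∧ (first π ≡ᵇ n)) (perms n))

c° : ℕ → ℕ → ℕ
c° n k = length (filterᵇ (λ π → inA k π ∧ (first π ≡ᵇ (n ∸ 1)) ∧ (lastE π ≡ᵇ 1)) (perms n))

-- The map π ↦ σ = extendCycle n π applies the transposition (1 n) to the entries
-- of π ∈ 𝔖ₙ₋₁ and appends a final 1; this inserts n into the cycle of π right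
-- before 1, so C(σ) = C(π) n, σ₁ = π₁ and σₙ = 1. It is injective and hits every
-- σ with σ₁ = n − 1 and σₙ = 1, so it remains to compare the three conditions.
-- Cyclicity is preserved. A 1342 in a rotation of C(π) n that uses n uses it as
-- the 4, and since C(π) starts with 1, n − 1, the entry n − 1 can take its place.
-- Finally σ contains δₖ iff π contains δₖ₋₁: the final 1 of σ extends any
-- decreasing subsequence of the rest, an n (standing where π has its 1) can be
-- traded for π₁ = n − 1, and conversely a decreasing subsequence of π ending in 1
-- may end in 2 instead, because 2 follows 1 in π once n − 1 ≥ k − 1 ≥ 3:
-- otherwise the rotation of C(π) starting at 2 reads 2, …, π⁻¹(1), 1, n − 1, …,
-- π⁻¹(2), a 1342.

module Submission where

open import Defs
open import Data.Nat using (ℕ; _≤_; _∸_)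
open import Relation.Binary.PropositionalEquality using (_≡_)

open import Data.Bool using (Bool; true; false; T; not; _∧_)
open import Data.Bool.ListAction using (all; any)
open import Data.Bool.Properties using (T?; T-∧; T-≡; T-not-≡; ⇔→≡)
open import Data.Empty using (⊥; ⊥-elim)
open import Data.List
  using (List; []; _∷_; [_]; _++_; length; map; concatMap; applyUpTo; upTo; filterᵇ; cartesianProductWith;
         take; drop; reverse; initLast; _∷ʳ′_)
open import Data.List.Membership.Propositional.Properties
open import Data.List.Membership.Propositional.Properties.WithK using (unique∧set⇒bag)
open import Data.List.Membership.Propositional using (_∈_; _∉_; find; lose)
open import Data.List.Properties
  using (∷-injective; ∷ʳ-injective; ++-assoc; ++-identityʳ; reverse-++; take++drop≡id; applyUpTo-∷ʳ;
         map-id; map-id-local; map-∘; map-cong; map-injective;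
         length-++; length-map; length-applyUpTo; length-reverse; length-take)
open import Data.List.Relation.Binary.BagAndSetEquality using (∼bag⇒↭)
open import Data.List.Relation.Binary.Permutation.Propositional.Properties using (↭-length)
open import Data.List.Relation.Binary.Sublist.Propositional
  using (_⊆_; []; _∷_; _∷ʳ_; ⊆-refl; ⊆-trans; minimum; from∈; lookup)
import Data.List.Relation.Binary.Sublist.Propositional.Properties as Sublist
open import Data.List.Relation.Unary.All as All using (All; []; _∷_)
open import Data.List.Relation.Unary.All.Properties
  using (all⁺; all⁻; ¬All⇒Any¬) renaming (++⁺ to All-++⁺; ++⁻ˡ to All-++⁻ˡ)
import Data.List.Relation.Unary.AllPairs.Properties as AllPairs
open import Data.List.Relation.Unary.AllPairs using (AllPairs; []; _∷_; uncons)
open import Data.List.Relation.Unary.Any using (here; there)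
open import Data.List.Relation.Unary.Any.Properties using (any⁺; any⁻)
open import Data.List.Relation.Unary.Unique.Propositional using (Unique)
import Data.List.Relation.Unary.Unique.Propositional.Properties as Unique
open import Data.Nat using (zero; suc; _+_; _<_; _>_; _≡ᵇ_; _<ᵇ_; z≤n; s≤s; z<s; s<s)
open import Data.Nat.Properties
open import Data.List.Membership.DecPropositional _≟_ using (_∈?_)
open import Data.Product using (∃; ∃₂; _×_; _,_; proj₁; proj₂; uncurry)
open import Data.Sum using (inj₁; inj₂)
open import Function using (_∘_; _⇔_; mk⇔; Equivalence)
open import Relation.Nullary using (¬_; yes; no; contradiction)
open import Relation.Binary.Definitions using (tri<; tri≈; tri>)
open import Relation.Binary.PropositionalEquality
  using (_≢_; ≢-sym; refl; sym; trans; cong; cong₂; subst; subst₂; module ≡-Reasoning)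

open Equivalence using (to; from)

unique∧set⇒length≡ : ∀ {A : Set} {xs ys : List A} → Unique xs → Unique ys →
                     (∀ {z} → z ∈ xs ⇔ z ∈ ys) → length xs ≡ length ys
unique∧set⇒length≡ uxs uys same = ↭-length (∼bag⇒↭ (unique∧set⇒bag uxs uys same))

unique∧subset⇒length≤ : ∀ {A : Set} {xs ys : List A} → Unique xs →
                        (∀ {z} → z ∈ xs → z ∈ ys) → length xs ≤ length ys
unique∧subset⇒length≤ [] _ = z≤n
unique∧subset⇒length≤ {xs = x ∷ xs} (x≢xs ∷ uxs) xs⊆ys
  with ys₁ , ys₂ , refl ← ∈-∃++ (xs⊆ys (here refl)) = begin
  suc (length xs)               ≤⟨ s≤s (unique∧subset⇒length≤ uxs xs⊆ys₁ys₂) ⟩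
  suc (length (ys₁ ++ ys₂))     ≡⟨ cong suc (length-++ ys₁) ⟩
  suc (length ys₁ + length ys₂) ≡⟨ +-suc (length ys₁) (length ys₂) ⟨
  length ys₁ + suc (length ys₂) ≡⟨ length-++ ys₁ ⟨
  length (ys₁ ++ x ∷ ys₂)       ∎
  where
  open ≤-Reasoning
  xs⊆ys₁ys₂ : ∀ {z} → z ∈ xs → z ∈ ys₁ ++ ys₂
  xs⊆ys₁ys₂ z∈xs with ∈-++⁻ ys₁ (xs⊆ys (there z∈xs))
  ... | inj₁ z∈ys₁         = ∈-++⁺ˡ z∈ys₁
  ... | inj₂ (here refl)   = contradiction refl (All.lookup x≢xs z∈xs)
  ... | inj₂ (there z∈ys₂) = ∈-++⁺ʳ ys₁ z∈ys₂

Unique-++-disjoint : ∀ {A : Set} {xs ys : List A} {x y} →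
                     Unique (xs ++ ys) → x ∈ xs → y ∈ ys → x ≢ y
Unique-++-disjoint {xs = _ ∷ xs} (x≢ ∷ _) (here refl) y∈ = All.lookup x≢ (∈-++⁺ʳ xs y∈)
Unique-++-disjoint {xs = _ ∷ _}  (_ ∷ u)  (there x∈)  y∈ = Unique-++-disjoint u x∈ y∈

Unique-resp-⊇ : ∀ {A : Set} {xs ys : List A} → xs ⊆ ys → Unique ys → Unique xs
Unique-resp-⊇ []            []        = []
Unique-resp-⊇ (_ ∷ʳ xs⊆)   (_ ∷ u)   = Unique-resp-⊇ xs⊆ u
Unique-resp-⊇ (refl ∷ xs⊆) (y≢ ∷ u)  =
  All.tabulate (λ z∈ → All.lookup y≢ (lookup xs⊆ z∈)) ∷ Unique-resp-⊇ xs⊆ u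

⊆-++⁻ : ∀ {A : Set} (ys : List A) {zs xs} → xs ⊆ ys ++ zs →
        ∃₂ λ p q → xs ≡ p ++ q × p ⊆ ys × q ⊆ zs
⊆-++⁻ []       xs⊆zs        = [] , _ , refl , [] , xs⊆zs
⊆-++⁻ (y ∷ ys) (.y ∷ʳ xs⊆)
  with p , q , refl , p⊆ , q⊆ ← ⊆-++⁻ ys xs⊆ = p , q , refl , y ∷ʳ p⊆ , q⊆
⊆-++⁻ (y ∷ ys) (refl ∷ xs⊆)
  with p , q , refl , p⊆ , q⊆ ← ⊆-++⁻ ys xs⊆ = y ∷ p , q , refl , refl ∷ p⊆ , q⊆

⊆-map⁻ : ∀ {A B : Set} (f : A → B) {xs} ys → xs ⊆ map f ys →
         ∃ λ zs → zs ⊆ ys × xs ≡ map f zs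
⊆-map⁻ f []       []           = [] , [] , refl
⊆-map⁻ f (y ∷ ys) (_ ∷ʳ xs⊆)
  with zs , zs⊆ , refl ← ⊆-map⁻ f ys xs⊆ = zs , y ∷ʳ zs⊆ , refl
⊆-map⁻ f (y ∷ ys) (refl ∷ xs⊆)
  with zs , zs⊆ , refl ← ⊆-map⁻ f ys xs⊆ = y ∷ zs , refl ∷ zs⊆ , refl

⊆-∷ʳ-replace : ∀ {A : Set} {xs : List A} {x y ys} → Unique ys →
               xs ++ [ x ] ⊆ ys → (x ∷ y ∷ []) ⊆ ys → xs ++ [ y ] ⊆ ys
⊆-∷ʳ-replace {xs = []}     _        (refl ∷ _) (refl ∷ q) = _ ∷ʳ q
⊆-∷ʳ-replace {xs = []}     (z≢ ∷ _) (refl ∷ _) (_ ∷ʳ q)   =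
  contradiction refl (All.lookup z≢ (lookup q (here refl)))
⊆-∷ʳ-replace {xs = _ ∷ xs} (z≢ ∷ _) (refl ∷ p) (refl ∷ _) =
  contradiction refl (All.lookup z≢ (lookup p (∈-++⁺ʳ xs (here refl))))
⊆-∷ʳ-replace {xs = _ ∷ _}  (_ ∷ u)  (refl ∷ p) (_ ∷ʳ q)   = refl ∷ ⊆-∷ʳ-replace u p q
⊆-∷ʳ-replace               (_ ∷ u)  (z ∷ʳ p)   (_ ∷ʳ q)   = z ∷ʳ ⊆-∷ʳ-replace u p q
⊆-∷ʳ-replace {xs = xs}     (z≢ ∷ _) (_ ∷ʳ p)   (refl ∷ _) =
  contradiction refl (All.lookup z≢ (lookup p (∈-++⁺ʳ xs (here refl))))

map-involutive : ∀ {A : Set} {f : A → A} → (∀ x → f (f x) ≡ x) → ∀ xs → map f (map f xs) ≡ xs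
map-involutive inv xs = trans (sym (map-∘ xs)) (trans (map-cong inv xs) (map-id xs))

∈-1⋯n : ∀ {z n} → 1 ≤ z → z ≤ n → z ∈ applyUpTo suc n
∈-1⋯n {suc z} _ z<n = ∈-applyUpTo⁺ suc z<n

applyUpTo-+ : ∀ {A : Set} (f : ℕ → A) a b →
              applyUpTo f (a + b) ≡ applyUpTo f a ++ applyUpTo (f ∘ (a +_)) b
applyUpTo-+ f zero    b = refl
applyUpTo-+ f (suc a) b = cong (f 0 ∷_) (applyUpTo-+ (f ∘ suc) a b)

applyUpTo-cong : ∀ {A : Set} {f g : ℕ → A} n → (∀ {i} → i < n → f i ≡ g i) →
                 applyUpTo f n ≡ applyUpTo g n
applyUpTo-cong zero    _  = refl
applyUpTo-cong (suc n) eq = cong₂ _∷_ (eq z<s) (applyUpTo-cong n (eq ∘ s<s))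

pair-⊆-applyUpTo : ∀ {A : Set} (f : ℕ → A) {i j n} → i < j → j < n →
                   (f i ∷ f j ∷ []) ⊆ applyUpTo f n
pair-⊆-applyUpTo f {zero}  {suc j} {suc n} _         (s≤s j<n) =
  refl ∷ from∈ (∈-applyUpTo⁺ (f ∘ suc) j<n)
pair-⊆-applyUpTo f {suc i} {suc j} {suc n} (s≤s i<j) (s≤s j<n) =
  f 0 ∷ʳ pair-⊆-applyUpTo (f ∘ suc) i<j j<n

head-view : ∀ (xs : List ℕ) → 0 < length xs → ∃ λ rest → xs ≡ at xs 1 ∷ rest
head-view (x ∷ rest) _ = rest , refl

at-∈ : ∀ xs {i} → i < length xs → at xs (suc i) ∈ xs
at-∈ (x ∷ xs) {zero}  _         = here refl
at-∈ (x ∷ xs) {suc i} (s≤s i<) = there (at-∈ xs i<)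

∈⇒at : ∀ {xs x} → x ∈ xs → ∃ λ i → i < length xs × at xs (suc i) ≡ x
∈⇒at (here refl) = zero , z<s , refl
∈⇒at (there x∈xs) with i , i< , eq ← ∈⇒at x∈xs = suc i , s<s i< , eq

at-injective : ∀ {xs} → Unique xs → ∀ {i j} → i < length xs → j < length xs →
               at xs (suc i) ≡ at xs (suc j) → i ≡ j
at-injective {x ∷ xs} _          {zero}  {zero}  _        _        _  = refl
at-injective {x ∷ xs} (x≢ ∷ _)   {zero}  {suc j} _        (s≤s j<) eq =
  contradiction eq (All.lookup x≢ (at-∈ xs j<))
at-injective {x ∷ xs} (x≢ ∷ _)   {suc i} {zero}  (s≤s i<) _        eq =
  contradiction (sym eq) (All.lookup x≢ (at-∈ xs i<))
at-injective {x ∷ xs} (_ ∷ uxs)  {suc i} {suc j} (s≤s i<) (s≤s j<) eq =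
  cong suc (at-injective uxs i< j< eq)

at-++ˡ : ∀ xs ys {i} → i < length xs → at (xs ++ ys) (suc i) ≡ at xs (suc i)
at-++ˡ (x ∷ xs) ys {zero}  _        = refl
at-++ˡ (x ∷ xs) ys {suc i} (s≤s i<) = at-++ˡ xs ys i<

at-++-length : ∀ xs y ys → at (xs ++ y ∷ ys) (suc (length xs)) ≡ y
at-++-length []       y ys = refl
at-++-length (x ∷ xs) y ys = at-++-length xs y ys

at-map : ∀ (f : ℕ → ℕ) xs {i} → i < length xs → at (map f xs) (suc i) ≡ f (at xs (suc i))
at-map f (x ∷ xs) {zero}  _        = refl
at-map f (x ∷ xs) {suc i} (s≤s i<) = at-map f xs i<

T-not : ∀ {b} → T (not b) ⇔ (¬ T b)
T-not {true}  = mk⇔ (λ ()) (λ ¬t → ¬t _)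
T-not {false} = mk⇔ (λ _ ()) (λ _ → _)

∈-filterᵇ⇔ : ∀ {A : Set} {p : A → Bool} {xs x} → x ∈ filterᵇ p xs ⇔ (x ∈ xs × T (p x))
∈-filterᵇ⇔ {p = p} = mk⇔ (∈-filter⁻ (T? ∘ p)) λ (x∈ , px) → ∈-filter⁺ (T? ∘ p) x∈ px

T-all⇔ : ∀ {A : Set} {p : A → Bool} {xs} → T (all p xs) ⇔ (∀ {x} → x ∈ xs → T (p x))
T-all⇔ {p = p} {xs} = mk⇔ pointwise collect
  where
  pointwise : T (all p xs) → ∀ {x} → x ∈ xs → T (p x)
  pointwise t = All.lookup (all⁺ p xs t)
  collect : (∀ {x} → x ∈ xs → T (p x)) → T (all p xs)
  collect h = all⁻ p (All.tabulate h)

T-all-applyUpTo : ∀ {p : ℕ → Bool} {n} → T (all p (applyUpTo suc n)) →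
                  ∀ {i} → i < n → T (p (suc i))
T-all-applyUpTo t i< = to T-all⇔ t (∈-applyUpTo⁺ suc i<)

¬T-all⇒ : ∀ {A : Set} {p : A → Bool} {xs} → ¬ T (all p xs) → ∃ λ x → x ∈ xs × ¬ T (p x)
¬T-all⇒ {p = p} {xs} ¬t = find (¬All⇒Any¬ (T? ∘ p) xs (¬t ∘ all⁻ p))

T-any⇔ : ∀ {A : Set} {p : A → Bool} {xs} → T (any p xs) ⇔ ∃ λ x → x ∈ xs × T (p x)
T-any⇔ {p = p} {xs} = mk⇔ (λ t → find (any⁻ p xs t)) (λ (x , x∈ , px) → any⁺ p (lose x∈ px))

<ᵇ-≡⇔ : ∀ {a b c d} → (a <ᵇ b) ≡ (c <ᵇ d) ⇔ (a < b ⇔ c < d)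
<ᵇ-≡⇔ {a} {b} {c} {d} =
  mk⇔ (λ eq → mk⇔ (transport eq) (transport (sym eq))) (λ iff → ⇔→≡ {z = true} (reflect iff))
  where
  transport : ∀ {a b c d} → (a <ᵇ b) ≡ (c <ᵇ d) → a < b → c < d
  transport {c = c} {d} eq a<b = <ᵇ⇒< c d (subst T eq (<⇒<ᵇ a<b))
  reflect : (a < b ⇔ c < d) → ((a <ᵇ b) ≡ true ⇔ (c <ᵇ d) ≡ true)
  reflect iff = mk⇔ (to T-≡ ∘ <⇒<ᵇ ∘ to iff ∘ <ᵇ⇒< a b ∘ from T-≡)
                    (to T-≡ ∘ <⇒<ᵇ ∘ from iff ∘ <ᵇ⇒< c d ∘ from T-≡)

<ᵇ-true : ∀ {a b} → a < b → (a <ᵇ b) ≡ true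
<ᵇ-true = to T-≡ ∘ <⇒<ᵇ

<ᵇ-false : ∀ {a b} → b ≤ a → (a <ᵇ b) ≡ false
<ᵇ-false {a} {b} b≤a with T? (a <ᵇ b)
... | yes t  = contradiction (<ᵇ⇒< a b t) (≤⇒≯ b≤a)
... | no  ¬t = to T-not-≡ (from T-not ¬t)

-- Permutations in one-line notation

record IsPerm (n : ℕ) (π : List ℕ) : Set where
  field
    length≡ : length π ≡ n
    bounded : ∀ {z} → z ∈ π → 1 ≤ z × z ≤ n
    unique  : Unique π

  complete : ∀ {y} → 1 ≤ y → y ≤ n → y ∈ π
  complete {y} 1≤y y≤n with y ∈? π
  ... | yes y∈π = y∈π
  ... | no  y∉π = contradiction too-long (<-irrefl refl)
    where
    y≢π : All (y ≢_) π
    y≢π = All.tabulate λ z∈π y≡z → y∉π (subst (_∈ π) (sym y≡z) z∈π)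
    in-range : ∀ {z} → z ∈ y ∷ π → z ∈ applyUpTo suc n
    in-range (here refl)  = ∈-1⋯n 1≤y y≤n
    in-range (there z∈π) = ∈-1⋯n (proj₁ (bounded z∈π)) (proj₂ (bounded z∈π))
    too-long : n < n
    too-long = subst₂ _≤_ (cong suc length≡) (length-applyUpTo suc n)
                          (unique∧subset⇒length≤ (y≢π ∷ unique) in-range)

  at-bounded : ∀ {x} → 1 ≤ x → x ≤ n → 1 ≤ at π x × at π x ≤ n
  at-bounded {suc i} _ i<n = bounded (at-∈ π (subst (i <_) (sym length≡) i<n))

  iter-bounded : 1 ≤ n → ∀ t → 1 ≤ iter π t 1 × iter π t 1 ≤ n
  iter-bounded 1≤n zero    = s≤s z≤n , 1≤n
  iter-bounded 1≤n (suc t) = uncurry at-bounded (iter-bounded 1≤n t)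

  at-injective-on : ∀ {x y} → 1 ≤ x → x ≤ n → 1 ≤ y → y ≤ n → at π x ≡ at π y → x ≡ y
  at-injective-on {suc i} {suc j} _ i<n _ j<n eq =
    cong suc (at-injective unique (subst (i <_) (sym length≡) i<n) (subst (j <_) (sym length≡) j<n) eq)

T-distinct⇔ : ∀ {xs} → T (distinct xs) ⇔ Unique xs
T-distinct⇔ = mk⇔ distinct⁻ distinct⁺
  where
  distinct⁻ : ∀ {xs} → T (distinct xs) → Unique xs
  distinct⁻ {[]}     _ = []
  distinct⁻ {x ∷ xs} t with x-new , rest ← to T-∧ t =
    All.tabulate (λ {y} y∈xs x≡y → to T-not x-new (from T-any⇔ (y , y∈xs , ≡⇒≡ᵇ x y x≡y)))
    ∷ distinct⁻ rest
  distinct⁺ : ∀ {xs} → Unique xs → T (distinct xs)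
  distinct⁺ {[]}     []         = _
  distinct⁺ {x ∷ xs} (x≢xs ∷ u) = from T-∧ (from T-not x-new , distinct⁺ u)
    where
    x-new : ¬ T (any (x ≡ᵇ_) xs)
    x-new t with y , y∈xs , x≡ᵇy ← to T-any⇔ t = All.lookup x≢xs y∈xs (≡ᵇ⇒≡ x y x≡ᵇy)

words-suc : ∀ l m → words (suc l) m ≡ cartesianProductWith _∷_ (applyUpTo suc m) (words l m)
words-suc l m = go (applyUpTo suc m)
  where
  go : ∀ hs → concatMap (λ a → map (a ∷_) (words l m)) hs
            ≡ cartesianProductWith _∷_ hs (words l m)
  go []       = refl
  go (h ∷ hs) = cong (map (h ∷_) (words l m) ++_) (go hs)

Unique-words : ∀ l m → Unique (words l m)
Unique-words zero    m = [] ∷ []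
Unique-words (suc l) m rewrite words-suc l m =
  Unique.cartesianProductWith⁺ _∷_ ∷-injective
    (Unique.applyUpTo⁺₁ suc m (λ i<j _ → <⇒≢ (s<s i<j))) (Unique-words l m)

Word : ℕ → ℕ → List ℕ → Set
Word l m w = length w ≡ l × (∀ {z} → z ∈ w → 1 ≤ z × z ≤ m)

∈-words⇔ : ∀ {l m w} → w ∈ words l m ⇔ Word l m w
∈-words⇔ = mk⇔ words⁻ words⁺
  where
  words⁻ : ∀ {l m w} → w ∈ words l m → Word l m w
  words⁻ {zero} (here refl) = refl , λ ()
  words⁻ {suc l} {m} w∈ rewrite words-suc l m
    with a , w′ , a∈ , w′∈ , refl ← ∈-cartesianProductWith⁻ _∷_ (applyUpTo suc m) (words l m) w∈
    with i , i<m , refl ← ∈-applyUpTo⁻ suc a∈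
    with len , bnd ← words⁻ {l} {m} w′∈ =
    cong suc len , λ { (here refl) → s≤s z≤n , i<m ; (there z∈) → bnd z∈ }
  words⁺ : ∀ {l m w} → Word l m w → w ∈ words l m
  words⁺ {zero}  {w = []}    _ = here refl
  words⁺ {suc l} {m} {_ ∷ w} (len , bnd) rewrite words-suc l m =
    ∈-cartesianProductWith⁺ _∷_ (∈-1⋯n (proj₁ (bnd (here refl))) (proj₂ (bnd (here refl))))
                              (words⁺ (suc-injective len , bnd ∘ there))

Unique-perms : ∀ n → Unique (perms n)
Unique-perms n = Unique.filter⁺ (T? ∘ distinct) (Unique-words n n)

∈-perms⇔ : ∀ {n π} → π ∈ perms n ⇔ IsPerm n π
∈-perms⇔ {n} {π} = mk⇔ perms⁻ perms⁺
  where
  perms⁻ : π ∈ perms n → IsPerm n π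
  perms⁻ π∈ with w∈ , d ← to ∈-filterᵇ⇔ π∈ with len , bnd ← to ∈-words⇔ w∈ =
    record { length≡ = len ; bounded = bnd ; unique = to T-distinct⇔ d }
  perms⁺ : IsPerm n π → π ∈ perms n
  perms⁺ p = from ∈-filterᵇ⇔ (from ∈-words⇔ (length≡ , bounded) , from T-distinct⇔ unique)
    where open IsPerm p

-- Patterns

∈-subseqs⇔ : ∀ {l s t} → t ∈ subseqs l s ⇔ (t ⊆ s × length t ≡ l)
∈-subseqs⇔ = mk⇔ subseqs⁻ (λ (t⊆s , len) → subseqs⁺ t⊆s len)
  where
  subseqs⁻ : ∀ {l s t} → t ∈ subseqs l s → t ⊆ s × length t ≡ l
  subseqs⁻ {zero}  {s}      (here refl) = minimum s , refl
  subseqs⁻ {suc l} {x ∷ xs} t∈ with ∈-++⁻ (map (x ∷_) (subseqs l xs)) t∈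
  ... | inj₂ t∈rest = let t⊆xs , len = subseqs⁻ t∈rest in x ∷ʳ t⊆xs , len
  ... | inj₁ t∈cons with t′ , t′∈ , refl ← ∈-map⁻ (x ∷_) t∈cons =
    let t′⊆xs , len = subseqs⁻ t′∈ in refl ∷ t′⊆xs , cong suc len
  subseqs⁺ : ∀ {l s t} → t ⊆ s → length t ≡ l → t ∈ subseqs l s
  subseqs⁺ {zero}  {t = []} _ _ = here refl
  subseqs⁺ {suc l} {x ∷ xs} (.x ∷ʳ t⊆xs) len =
    ∈-++⁺ʳ (map (x ∷_) (subseqs l xs)) (subseqs⁺ t⊆xs len)
  subseqs⁺ {suc l} (refl ∷ t⊆xs) len = ∈-++⁺ˡ (∈-map⁺ _ (subseqs⁺ t⊆xs (suc-injective len)))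

OrderAgree : List ℕ → List ℕ → Set
OrderAgree s σ = ∀ {i j} → i < length σ → j < length σ →
                 (at s (suc i) < at s (suc j) ⇔ at σ (suc i) < at σ (suc j))

-- orderIso compares two comparisons with a Boolean function local to Defs, so a
-- table entry only reduces once both comparisons are with-abstracted, and that
-- abstraction only succeeds when the first argument of T-∧ is given explicitly.
T-orderIso⇔ : ∀ {s σ} → T (orderIso s σ) ⇔ (length s ≡ length σ × OrderAgree s σ)
T-orderIso⇔ {s} {σ} =
  mk⇔ (λ t → ≡ᵇ⇒≡ _ _ (proj₁ (to T-∧ t)) , λ {i} {j} i< j< → to <ᵇ-≡⇔ (agree t {i} {j} i< j<)) agreed
  where
  positions : List ℕ
  positions = applyUpTo suc (length σ)
  agree : T (orderIso s σ) → ∀ {i j} → i < length σ → j < length σ →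
          (at s (suc i) <ᵇ at s (suc j)) ≡ (at σ (suc i) <ᵇ at σ (suc j))
  agree t {i} {j} i< j<
    with at s (suc i) <ᵇ at s (suc j) | at σ (suc i) <ᵇ at σ (suc j)
       | T-all-applyUpTo (T-all-applyUpTo (proj₂ (to (T-∧ {length s ≡ᵇ length σ}) t)) i<) j<
  ... | true  | true  | _  = refl
  ... | false | false | _  = refl
  ... | true  | false | ()
  ... | false | true  | ()
  agreed : length s ≡ length σ × OrderAgree s σ → T (orderIso s σ)
  agreed (len , ag) with T? (orderIso s σ)
  ... | yes t = t
  ... | no ¬t
    with i′ , i′∈ , ¬row ← ¬T-all⇒ {xs = positions}
                               (λ rows → ¬t (from T-∧ (≡⇒≡ᵇ _ _ len , rows)))
    with j′ , j′∈ , ¬cell ← ¬T-all⇒ {xs = positions} ¬row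
    with i , i< , refl ← ∈-applyUpTo⁻ suc {n = length σ} i′∈
    with j , j< , refl ← ∈-applyUpTo⁻ suc {n = length σ} j′∈
    with at s (suc i) <ᵇ at s (suc j) | at σ (suc i) <ᵇ at σ (suc j)
       | ¬cell | from <ᵇ-≡⇔ (ag i< j<)
  ... | true  | true  | ¬c | _  = ⊥-elim (¬c _)
  ... | false | false | ¬c | _  = ⊥-elim (¬c _)
  ... | true  | false | _  | ()
  ... | false | true  | _  | ()

T-contains⇔ : ∀ {σ s} → T (contains σ s) ⇔ ∃ λ t → t ⊆ s × T (orderIso t σ)
T-contains⇔ {σ} {s} = mk⇔ found witness
  where
  any⇔ : T (contains σ s) ⇔ ∃ λ t → t ∈ subseqs (length σ) s × T (orderIso t σ)
  any⇔ = T-any⇔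
  found : T (contains σ s) → ∃ λ t → t ⊆ s × T (orderIso t σ)
  found c with t , t∈ , iso ← to any⇔ c = t , proj₁ (to (∈-subseqs⇔ {length σ} {s} {t}) t∈) , iso
  witness : (∃ λ t → t ⊆ s × T (orderIso t σ)) → T (contains σ s)
  witness (t , t⊆s , iso) = from any⇔
    (t , from (∈-subseqs⇔ {length σ} {s} {t}) (t⊆s , proj₁ (to (T-orderIso⇔ {t} {σ}) iso)) , iso)

Decreasing : List ℕ → Set
Decreasing = AllPairs _>_

HasDecreasing : ℕ → List ℕ → Set
HasDecreasing k s = ∃ λ t → t ⊆ s × Decreasing t × length t ≡ k

DecreasingAt : List ℕ → Set
DecreasingAt t = ∀ {i j} → i < j → j < length t → at t (suc j) < at t (suc i)

Decreasing⇔at : ∀ {t} → Decreasing t ⇔ DecreasingAt t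
Decreasing⇔at = mk⇔ decreasing⁻ decreasing⁺
  where
  decreasing⁻ : ∀ {t} → Decreasing t → DecreasingAt t
  decreasing⁻ {x ∷ xs} (x>xs ∷ _) {zero}  {suc j} _        (s≤s j<) = All.lookup x>xs (at-∈ xs j<)
  decreasing⁻ {x ∷ xs} (_ ∷ dec)  {suc i} {suc j} (s≤s i<j) (s≤s j<) = decreasing⁻ dec i<j j<
  decreasing⁺ : ∀ {t} → DecreasingAt t → Decreasing t
  decreasing⁺ {[]}     _ = []
  decreasing⁺ {x ∷ xs} h = All.tabulate head> ∷ decreasing⁺ (λ i<j j< → h (s<s i<j) (s<s j<))
    where
    head> : ∀ {y} → y ∈ xs → x > y
    head> y∈ with j , j< , refl ← ∈⇒at y∈ = h z<s (s<s j<)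

Decreasing-at-<⇔ : ∀ {t} → Decreasing t → ∀ {i j} → i < length t → j < length t →
                   (at t (suc i) < at t (suc j) ⇔ j < i)
Decreasing-at-<⇔ {t} dec {i} {j} i< j< = mk⇔ forward (λ j<i → to Decreasing⇔at dec j<i i<)
  where
  forward : at t (suc i) < at t (suc j) → j < i
  forward lt with <-cmp i j
  ... | tri< i<j _ _ = contradiction lt (<⇒≯ (to Decreasing⇔at dec i<j j<))
  ... | tri≈ _ refl _ = contradiction lt (<-irrefl refl)
  ... | tri> _ _ j<i = j<i

Decreasing-OrderAgree : ∀ {t u} → Decreasing t → Decreasing u → length t ≡ length u →
                        OrderAgree t u
Decreasing-OrderAgree {t} dt du len {i} {j} i< j< =
  mk⇔ (from (Decreasing-at-<⇔ du i< j<) ∘ to (Decreasing-at-<⇔ dt i<′ j<′))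
      (from (Decreasing-at-<⇔ dt i<′ j<′) ∘ to (Decreasing-at-<⇔ du i< j<))
  where
  i<′ : i < length t
  i<′ = subst (i <_) (sym len) i<
  j<′ : j < length t
  j<′ = subst (j <_) (sym len) j<

OrderAgree-Decreasing : ∀ {t u} → OrderAgree t u → Decreasing u → length t ≡ length u →
                        Decreasing t
OrderAgree-Decreasing ag du len = from Decreasing⇔at λ i<j j< →
  let j<′ = ≤-trans j< (≤-reflexive len) in
  from (ag j<′ (<-trans i<j j<′)) (to Decreasing⇔at du i<j j<′)

Decreasing-++⁻ˡ : ∀ xs {ys} → Decreasing (xs ++ ys) → Decreasing xs
Decreasing-++⁻ˡ []       _           = []
Decreasing-++⁻ˡ (x ∷ xs) (x> ∷ dec) = All-++⁻ˡ xs x> ∷ Decreasing-++⁻ˡ xs dec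

Decreasing-∷ʳ-above : ∀ xs {x} → Decreasing (xs ++ [ x ]) → All (_> x) xs
Decreasing-∷ʳ-above []       _           = []
Decreasing-∷ʳ-above (y ∷ xs) (y> ∷ dec) =
  All.lookup y> (∈-++⁺ʳ xs (here refl)) ∷ Decreasing-∷ʳ-above xs dec

HasDecreasing-∷ʳ-min : ∀ {k s x} → (∀ {z} → z ∈ s → x < z) →
                       HasDecreasing (suc k) (s ++ [ x ]) ⇔ HasDecreasing k s
HasDecreasing-∷ʳ-min {k} {s} {x} x-min = mk⇔ drop-last add-last
  where
  drop-last : HasDecreasing (suc k) (s ++ [ x ]) → HasDecreasing k s
  drop-last (t , t⊆ , dec , len) with ⊆-++⁻ s t⊆
  ... | y ∷ p , [] , refl , yp⊆s , _ =
    p , Sublist.∷ˡ⁻ yp⊆s , proj₂ (uncons (subst Decreasing (++-identityʳ (y ∷ p)) dec)) ,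
    suc-injective (trans (sym (cong length (++-identityʳ (y ∷ p)))) len)
  ... | p , _ ∷ [] , refl , p⊆s , _ =
    p , p⊆s , Decreasing-++⁻ˡ p dec ,
    suc-injective (trans (+-comm 1 (length p)) (trans (sym (length-++ p)) len))
  ... | [] , [] , refl , _ , _ = contradiction len 0≢1+n
  ... | _ , _ ∷ _ ∷ _ , _ , _ , (_ ∷ʳ ())
  ... | _ , _ ∷ _ ∷ _ , _ , _ , (_ ∷ ())
  add-last : HasDecreasing k s → HasDecreasing (suc k) (s ++ [ x ])
  add-last (t , t⊆ , dec , len) =
    t ++ [ x ] , Sublist.++⁺ t⊆ ⊆-refl ,
    AllPairs.++⁺ dec ([] ∷ []) (All.tabulate λ z∈ → x-min (lookup t⊆ z∈) ∷ []) ,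
    trans (length-++ t) (trans (+-comm (length t) 1) (cong suc len))

δ-suc : ∀ k → δ (suc k) ≡ suc k ∷ δ k
δ-suc k = trans (cong reverse (sym (applyUpTo-∷ʳ suc k))) (reverse-++ (applyUpTo suc k) [ suc k ])

length-δ : ∀ k → length (δ k) ≡ k
length-δ k = trans (length-reverse (applyUpTo suc k)) (length-applyUpTo suc k)

Decreasing-δ : ∀ k → Decreasing (δ k)
Decreasing-δ k = proj₂ (bounded-decreasing k)
  where
  bounded-decreasing : ∀ k → All (_≤ k) (δ k) × Decreasing (δ k)
  bounded-decreasing zero = [] , []
  bounded-decreasing (suc k) rewrite δ-suc k with bnd , dec ← bounded-decreasing k =
    ≤-refl ∷ All.map m≤n⇒m≤1+n bnd , All.map s≤s bnd ∷ dec

T-contains-δ⇔ : ∀ {k s} → T (contains (δ k) s) ⇔ HasDecreasing k s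
T-contains-δ⇔ {k} {s} = mk⇔ found witness
  where
  found : T (contains (δ k) s) → HasDecreasing k s
  found c with t , t⊆s , iso ← to (T-contains⇔ {δ k}) c
    with len , ag ← to (T-orderIso⇔ {t} {δ k}) iso =
    t , t⊆s , OrderAgree-Decreasing ag (Decreasing-δ k) len , trans len (length-δ k)
  witness : HasDecreasing k s → T (contains (δ k) s)
  witness (t , t⊆s , dec , len) = from (T-contains⇔ {δ k})
    (t , t⊆s , from (T-orderIso⇔ {t} {δ k}) (len′ , Decreasing-OrderAgree dec (Decreasing-δ k) len′))
    where
    len′ : length t ≡ length (δ k)
    len′ = trans len (sym (length-δ k))

Has1342 : List ℕ → Set
Has1342 s = ∃ λ a → ∃ λ b → ∃ λ c → ∃ λ d →
  (a ∷ b ∷ c ∷ d ∷ []) ⊆ s × a < d × d < b × b < c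

Has1342-mono : ∀ {s s′} → s ⊆ s′ → Has1342 s → Has1342 s′
Has1342-mono s⊆s′ (a , b , c , d , sub , order) = a , b , c , d , ⊆-trans sub s⊆s′ , order

T-contains-1342⇔ : ∀ {s} → T (contains p1342 s) ⇔ Has1342 s
T-contains-1342⇔ {s} = mk⇔ found witness
  where
  found : T (contains p1342 s) → Has1342 s
  found c with t , t⊆s , iso ← to (T-contains⇔ {p1342}) c =
    uncurry (occurrence t⊆s) (to (T-orderIso⇔ {t} {p1342}) iso)
    where
    occurrence : ∀ {t} → t ⊆ s → length t ≡ 4 → OrderAgree t p1342 → Has1342 s
    occurrence {a ∷ b ∷ c ∷ d ∷ []} t⊆s _ ag =
      a , b , c , d , t⊆s , from (ag z<s (s<s (s<s (s<s z<s)))) (s<s z<s)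
                          , from (ag (s<s (s<s (s<s z<s))) (s<s z<s)) (s<s (s<s z<s))
                          , from (ag (s<s z<s) (s<s (s<s z<s))) (s<s (s<s (s<s z<s)))
    occurrence {[]}                   _ () _
    occurrence {_ ∷ []}               _ () _
    occurrence {_ ∷ _ ∷ []}           _ () _
    occurrence {_ ∷ _ ∷ _ ∷ []}       _ () _
    occurrence {_ ∷ _ ∷ _ ∷ _ ∷ _ ∷ _} _ () _
  iso1342 : ∀ {a b c d} → a < d → d < b → b < c → T (orderIso (a ∷ b ∷ c ∷ d ∷ []) p1342)
  iso1342 {a} {b} {c} {d} a<d d<b b<c
    rewrite <ᵇ-true a<d | <ᵇ-true d<b | <ᵇ-true b<c | <ᵇ-true (<-trans a<d d<b)
          | <ᵇ-true (<-trans (<-trans a<d d<b) b<c) | <ᵇ-true (<-trans d<b b<c)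
          | <ᵇ-false (<⇒≤ a<d) | <ᵇ-false (<⇒≤ d<b) | <ᵇ-false (<⇒≤ b<c)
          | <ᵇ-false (<⇒≤ (<-trans a<d d<b)) | <ᵇ-false (<⇒≤ (<-trans (<-trans a<d d<b) b<c))
          | <ᵇ-false (<⇒≤ (<-trans d<b b<c))
          | <ᵇ-false (≤-refl {a}) | <ᵇ-false (≤-refl {b})
          | <ᵇ-false (≤-refl {c}) | <ᵇ-false (≤-refl {d})
          = _
  witness : Has1342 s → T (contains p1342 s)
  witness (a , b , c , d , t⊆s , a<d , d<b , b<c) =
    from (T-contains⇔ {p1342}) (_ , t⊆s , iso1342 a<d d<b b<c)

-- Cyclic permutations and cycle forms

rotate-++ : ∀ (X Y : List ℕ) → rotate (length X) (X ++ Y) ≡ Y ++ X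
rotate-++ []      Y = sym (++-identityʳ Y)
rotate-++ (x ∷ X) Y = begin
  rotate (length X) ((X ++ Y) ++ [ x ]) ≡⟨ cong (rotate (length X)) (++-assoc X Y [ x ]) ⟩
  rotate (length X) (X ++ Y ++ [ x ])   ≡⟨ rotate-++ X (Y ++ [ x ]) ⟩
  (Y ++ [ x ]) ++ X                     ≡⟨ ++-assoc Y [ x ] X ⟩
  Y ++ x ∷ X                            ∎
  where open ≡-Reasoning

CyclicallyAvoids1342 : List ℕ → Set
CyclicallyAvoids1342 L = ∀ X Y → L ≡ X ++ Y → ¬ Has1342 (Y ++ X)

rotation-index : ∀ X Y → Has1342 (Y ++ X) →
                 ∃ λ i → i < length (X ++ Y) × rotate i (X ++ Y) ≡ Y ++ X
rotation-index X []      (_ , _ , _ , _ , sub , _) =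
  0 , subst (0 <_) (cong length (sym (++-identityʳ X))) (≤-trans (s≤s z≤n) (Sublist.length-mono-≤ sub)) ,
  ++-identityʳ X
rotation-index X (y ∷ Y) _ =
  length X , subst (length X <_) (sym (length-++ X)) (m<m+n (length X) z<s) , rotate-++ X (y ∷ Y)

T-rotations-avoid⇔ : ∀ {L} → T (all (avoids p1342) (rotations L)) ⇔ CyclicallyAvoids1342 L
T-rotations-avoid⇔ {L} = mk⇔ avoided checked
  where
  all⇔ : T (all (avoids p1342) (rotations L)) ⇔ (∀ {r} → r ∈ rotations L → T (avoids p1342 r))
  all⇔ = T-all⇔
  avoided : T (all (avoids p1342) (rotations L)) → CyclicallyAvoids1342 L
  avoided t X Y refl has with i , i< , rot ← rotation-index X Y has =
    to T-not (to all⇔ t (∈-applyUpTo⁺ (λ i → rotate i L) i<))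
             (from T-contains-1342⇔ (subst Has1342 (sym rot) has))
  checked : CyclicallyAvoids1342 L → T (all (avoids p1342) (rotations L))
  checked h = from all⇔ rotation-avoids
    where
    rotation-avoids : ∀ {r} → r ∈ rotations L → T (avoids p1342 r)
    rotation-avoids r∈ with i , i< , refl ← ∈-applyUpTo⁻ (λ i → rotate i L) r∈ =
      from T-not λ c → h X Y (sym (take++drop≡id i L)) (subst Has1342 rot (to T-contains-1342⇔ c))
      where
      X Y : List ℕ
      X = take i L
      Y = drop i L
      length-X : length X ≡ i
      length-X = trans (length-take i L) (m≤n⇒m⊓n≡m (<⇒≤ i<))
      rot : rotate i L ≡ Y ++ X
      rot = begin
        rotate i L                 ≡⟨ cong (λ j → rotate j L) length-X ⟨
        rotate (length X) L        ≡⟨ cong (rotate (length X)) (take++drop≡id i L) ⟨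
        rotate (length X) (X ++ Y) ≡⟨ rotate-++ X Y ⟩
        Y ++ X                     ∎
        where open ≡-Reasoning

Cyclic : List ℕ → Set
Cyclic π = ∀ {i} → i < length π ∸ 1 → iter π (suc i) 1 ≢ 1

T-cyclic⇔ : ∀ {π} → T (cyclic π) ⇔ Cyclic π
T-cyclic⇔ {π} =
  mk⇔ (λ t {i} i< eq → to T-not (to all⇔ t (∈-upTo⁺ i<)) (≡⇒≡ᵇ _ 1 eq)) never-back
  where
  all⇔ : T (cyclic π) ⇔ (∀ {i} → i ∈ upTo (length π ∸ 1) → T (not (iter π (suc i) 1 ≡ᵇ 1)))
  all⇔ = T-all⇔
  never-back : Cyclic π → T (cyclic π)
  never-back h = from all⇔ λ i∈ → from T-not (h (∈-upTo⁻ i∈) ∘ ≡ᵇ⇒≡ _ 1)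

InA : ℕ → List ℕ → Set
InA k π = Cyclic π × ¬ HasDecreasing k π × CyclicallyAvoids1342 (cycleForm π)

T-inA⇔ : ∀ {k π} → T (inA k π) ⇔ InA k π
T-inA⇔ {k} {π} = mk⇔ split join
  where
  cyclic⇔ : T (cyclic π) ⇔ Cyclic π
  cyclic⇔ = T-cyclic⇔ {π}
  δ⇔ : T (contains (δ k) π) ⇔ HasDecreasing k π
  δ⇔ = T-contains-δ⇔ {k}
  rotations⇔ : T (all (avoids p1342) (rotations (cycleForm π))) ⇔ CyclicallyAvoids1342 (cycleForm π)
  rotations⇔ = T-rotations-avoid⇔ {cycleForm π}
  split : T (inA k π) → InA k π
  split t with cyc , rest ← to (T-∧ {cyclic π}) t with av , rot ← to (T-∧ {avoids (δ k) π}) rest =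
    to cyclic⇔ cyc , to T-not av ∘ from δ⇔ , to rotations⇔ rot
  join : InA k π → T (inA k π)
  join (cyc , av , rot) = from (T-∧ {cyclic π})
    (from cyclic⇔ cyc , from (T-∧ {avoids (δ k) π}) (from T-not (av ∘ to δ⇔) , from rotations⇔ rot))

∷ʳ-rotation : ∀ {L n} X′ Y′ → L ++ [ n ] ≡ X′ ++ Y′ →
              ∃₂ λ (X Y : List ℕ) → L ≡ X ++ Y × Y′ ++ X′ ≡ Y ++ n ∷ X
∷ʳ-rotation {L} X′ Y′ eq with initLast Y′
... | []        = [] , L , refl , sym (trans eq (++-identityʳ X′))
... | Y ∷ʳ′ y with L≡ , refl ← ∷ʳ-injective L (X′ ++ Y) (trans eq (sym (++-assoc X′ Y [ y ]))) =
  X′ , Y , L≡ , ++-assoc Y [ y ] X′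

-- The m right after the leading 1 of X exceeds b, so it can serve as the 4.
Has1342-via-second : ∀ {m X Y L′ a b d} → Unique (X ++ Y) → (∀ {z} → z ∈ X ++ Y → 1 ≤ z × z ≤ m) →
                     X ++ Y ≡ 1 ∷ m ∷ L′ → (a ∷ b ∷ []) ⊆ Y → [ d ] ⊆ X → a < d → d < b →
                     Has1342 (Y ++ X)
Has1342-via-second {X = []} _ _ _ _ () _ _
Has1342-via-second {X = _ ∷ []} _ bnd refl ab⊆Y (refl ∷ _) a<d _ =
  contradiction a<d (≤⇒≯ (proj₁ (bnd (∈-++⁺ʳ [ 1 ] (lookup ab⊆Y (here refl))))))
Has1342-via-second {X = _ ∷ []} _ _ refl _ (_ ∷ʳ ()) _ _
Has1342-via-second {X = _ ∷ _ ∷ X} _ bnd refl ab⊆Y (refl ∷ _) a<d _ =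
  contradiction a<d (≤⇒≯ (proj₁ (bnd (∈-++⁺ʳ (1 ∷ _ ∷ X) (lookup ab⊆Y (here refl))))))
Has1342-via-second {X = _ ∷ _ ∷ X} _ bnd refl ab⊆Y (_ ∷ʳ (refl ∷ _)) _ d<b =
  contradiction d<b (≤⇒≯ (proj₂ (bnd (∈-++⁺ʳ (1 ∷ _ ∷ X) (lookup ab⊆Y (there (here refl)))))))
Has1342-via-second {m} {X = _ ∷ _ ∷ X} {Y} {a = a} {b} {d} u bnd refl ab⊆Y (_ ∷ʳ (_ ∷ʳ d⊆X)) a<d d<b =
  a , b , m , d , Sublist.++⁺ ab⊆Y (1 ∷ʳ (refl ∷ d⊆X)) , a<d , d<b , b<m
  where
  b∈Y : b ∈ Y
  b∈Y = lookup ab⊆Y (there (here refl))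
  b<m : b < m
  b<m = ≤∧≢⇒< (proj₂ (bnd (∈-++⁺ʳ (1 ∷ m ∷ X) b∈Y)))
              (≢-sym (Unique-++-disjoint u (there (here refl)) b∈Y))

CyclicallyAvoids1342-∷ʳ : ∀ {m n L L′} → IsPerm m L → L ≡ 1 ∷ m ∷ L′ → m < n →
                          CyclicallyAvoids1342 (L ++ [ n ]) ⇔ CyclicallyAvoids1342 L
CyclicallyAvoids1342-∷ʳ {m} {n} {L} perm L≡ m<n = mk⇔ shrink extend
  where
  open IsPerm perm
  shrink : CyclicallyAvoids1342 (L ++ [ n ]) → CyclicallyAvoids1342 L
  shrink h X Y L≡XY has = h X (Y ++ [ n ]) (trans (cong (_++ [ n ]) L≡XY) (++-assoc X Y [ n ]))
    (Has1342-mono (Sublist.++⁺ (Sublist.++⁺ʳ [ n ] (⊆-refl {x = Y})) ⊆-refl) has)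
  below-n : ∀ {z} → z ∈ L → z < n
  below-n z∈ = ≤-<-trans (proj₂ (bounded z∈)) m<n
  below-n-X : ∀ {X Y z} → L ≡ X ++ Y → z ∈ X → z < n
  below-n-X L≡XY z∈X = below-n (subst (_ ∈_) (sym L≡XY) (∈-++⁺ˡ z∈X))
  below-n-Y : ∀ {X Y z} → L ≡ X ++ Y → z ∈ Y → z < n
  below-n-Y {X} L≡XY z∈Y = below-n (subst (_ ∈_) (sym L≡XY) (∈-++⁺ʳ X z∈Y))
  drop-n : ∀ X Y → L ≡ X ++ Y → Has1342 (Y ++ n ∷ X) → Has1342 (Y ++ X)
  drop-n X Y L≡XY (a , b , c , d , sub , a<d , d<b , b<c) with ⊆-++⁻ Y sub
  ... | p , q , eq , p⊆Y , (_ ∷ʳ q⊆X) =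
    a , b , c , d , subst (_⊆ Y ++ X) (sym eq) (Sublist.++⁺ p⊆Y q⊆X) , a<d , d<b , b<c
  ... | [] , _ , refl , _ , (refl ∷ q⊆X) =
    contradiction a<d (<⇒≯ (below-n-X L≡XY (lookup q⊆X (there (there (here refl))))))
  ... | _ ∷ [] , _ , refl , _ , (refl ∷ q⊆X) =
    contradiction b<c (<⇒≯ (below-n-X L≡XY (lookup q⊆X (here refl))))
  ... | _ ∷ _ ∷ [] , _ , refl , ab⊆Y , (refl ∷ d⊆X) =
    Has1342-via-second (subst Unique L≡XY unique) (bounded ∘ subst (_ ∈_) (sym L≡XY))
                       (trans (sym L≡XY) L≡) ab⊆Y d⊆X a<d d<b
  ... | _ ∷ _ ∷ _ ∷ [] , _ , refl , abc⊆Y , (refl ∷ _) =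
    contradiction d<b (<⇒≯ (below-n-Y {X} L≡XY (lookup abc⊆Y (there (here refl)))))
  ... | _ ∷ _ ∷ _ ∷ _ ∷ [] , _ , () , _ , (refl ∷ _)
  ... | _ ∷ _ ∷ _ ∷ _ ∷ _ ∷ _ , _ , () , _ , (refl ∷ _)
  extend : CyclicallyAvoids1342 L → CyclicallyAvoids1342 (L ++ [ n ])
  extend h X′ Y′ eq has with X , Y , L≡XY , rot ← ∷ʳ-rotation X′ Y′ eq =
    h X Y L≡XY (drop-n X Y L≡XY (subst Has1342 rot has))

module CyclicPerm {m₁ π} (perm : IsPerm (suc m₁) π) (cyc : Cyclic π) where

  open IsPerm perm

  m : ℕ
  m = suc m₁

  orbit : ℕ → ℕ
  orbit t = iter π t 1

  orbit-bounded : ∀ t → 1 ≤ orbit t × orbit t ≤ m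
  orbit-bounded = iter-bounded (s≤s z≤n)

  orbit-pred : ∀ a b → orbit (suc a) ≡ orbit (suc b) → orbit a ≡ orbit b
  orbit-pred a b = uncurry (uncurry at-injective-on (orbit-bounded a)) (orbit-bounded b)

  orbit-no-return : ∀ {e} → e < m₁ → orbit (suc e) ≢ 1
  orbit-no-return e< = cyc (subst (_ <_) (sym (cong (_∸ 1) length≡)) e<)

  orbit-shift : ∀ a e → orbit a ≡ orbit (a + e) → 1 ≡ orbit e
  orbit-shift zero    e eq = eq
  orbit-shift (suc a) e eq = orbit-shift a e (orbit-pred a (a + e) eq)

  orbit-distinct : ∀ {i j} → i < j → j < m → orbit i ≢ orbit j
  orbit-distinct {i} i<j j<m eq with o , refl ← m≤n⇒∃[o]m+o≡n i<j =
    orbit-no-return (≤-trans (s≤s (m≤n+m o i)) (≤-pred j<m))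
                    (sym (orbit-shift i (suc o) (trans eq (cong orbit (sym (+-suc i o))))))

  orbit-injective : ∀ {i j} → i < m → j < m → orbit i ≡ orbit j → i ≡ j
  orbit-injective {i} {j} i<m j<m eq with <-cmp i j
  ... | tri< i<j _ _ = contradiction eq (orbit-distinct i<j j<m)
  ... | tri≈ _ i≡j _ = i≡j
  ... | tri> _ _ j<i = contradiction (sym eq) (orbit-distinct j<i i<m)

  cycleForm≡ : cycleForm π ≡ applyUpTo orbit m
  cycleForm≡ = cong (applyUpTo orbit) length≡

  cycleForm-isPerm : IsPerm m (cycleForm π)
  cycleForm-isPerm = subst (IsPerm m) (sym cycleForm≡) (record
    { length≡ = length-applyUpTo orbit m
    ; bounded = λ z∈ → let i , _ , z≡ = ∈-applyUpTo⁻ orbit z∈ in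
                       subst (λ z → 1 ≤ z × z ≤ m) (sym z≡) (orbit-bounded i)
    ; unique  = Unique.applyUpTo⁺₁ orbit m orbit-distinct
    })

  ∈-orbit : ∀ {y} → 1 ≤ y → y ≤ m → y ∈ applyUpTo orbit m
  ∈-orbit 1≤y y≤m = subst (_ ∈_) cycleForm≡ (IsPerm.complete cycleForm-isPerm 1≤y y≤m)

  orbit-index : ∀ {y} → 1 ≤ y → y ≤ m → ∃ λ i → i < m × orbit i ≡ y
  orbit-index 1≤y y≤m with i , i<m , eq ← ∈-applyUpTo⁻ orbit (∈-orbit 1≤y y≤m) = i , i<m , sym eq

  orbit-period : orbit m ≡ 1
  orbit-period with orbit-index (proj₁ (orbit-bounded m)) (proj₂ (orbit-bounded m))
  ... | zero  , _ , eq      = sym eq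
  ... | suc i , s≤s i<m₁ , eq = contradiction (orbit-pred i m₁ eq) (orbit-distinct i<m₁ (n<1+n m₁))

  cycleForm-shape : at π 1 ≡ m → 1 ≤ m₁ → ∃ λ L′ → cycleForm π ≡ 1 ∷ m ∷ L′
  cycleForm-shape π₁≡m 1≤m₁ = L′ , (begin
    cycleForm π              ≡⟨ cycleForm≡ ⟩
    applyUpTo orbit (suc m₁) ≡⟨ cong (applyUpTo orbit ∘ suc) (m+[n∸m]≡n 1≤m₁) ⟨
    1 ∷ at π 1 ∷ L′          ≡⟨ cong (λ x → 1 ∷ x ∷ L′) π₁≡m ⟩
    1 ∷ m ∷ L′               ∎)
    where
    open ≡-Reasoning
    L′ : List ℕ
    L′ = applyUpTo (orbit ∘ suc ∘ suc) (m₁ ∸ 1)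

  module _ (π₁≡m : at π 1 ≡ m) (avoid : CyclicallyAvoids1342 (cycleForm π)) where

    -- The rotation of the cycle form starting at 2 reads 2, …, j, 1, m, …, r:
    -- a 1342 as soon as 2 < r < j < m.
    no-1342-rotation : ∀ {s r j} → orbit s ≡ r → orbit (suc s) ≡ 2 → suc s < m → orbit m₁ ≡ j →
                       2 < r → r < j → j < m → ⊥
    no-1342-rotation {zero}     orbit-s _ _ _ 2<r _   _   =
      contradiction orbit-s (<⇒≢ (<-trans (s<s z<s) 2<r))
    no-1342-rotation {suc zero} orbit-s _ _ _ _   r<j j<m =
      contradiction (trans (sym π₁≡m) orbit-s) (>⇒≢ (<-trans r<j j<m))
    no-1342-rotation {s@(suc (suc _))} {r} {j} orbit-s orbit-ss ss<m orbit-m₁ 2<r r<j j<m =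
      avoid X Y split (2 , j , m , r , Sublist.++⁺ 2j⊆Y mr⊆X , 2<r , r<j , j<m)
      where
      1<s : 1 < s
      1<s = s≤s (s≤s z≤n)
      ss<m₁ : suc s < m₁
      ss<m₁ = ≤∧≢⇒< (≤-pred ss<m) λ ss≡m₁ →
        <⇒≢ (<-trans 2<r r<j) (trans (sym orbit-ss) (trans (cong orbit ss≡m₁) orbit-m₁))
      X Y : List ℕ
      X = applyUpTo orbit (suc s)
      Y = applyUpTo (orbit ∘ (suc s +_)) (m ∸ suc s)
      split : cycleForm π ≡ X ++ Y
      split = begin
        cycleForm π                           ≡⟨ cycleForm≡ ⟩
        applyUpTo orbit m                     ≡⟨ cong (applyUpTo orbit) (m+[n∸m]≡n (<⇒≤ ss<m)) ⟨
        applyUpTo orbit (suc s + (m ∸ suc s)) ≡⟨ applyUpTo-+ orbit (suc s) (m ∸ suc s) ⟩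
        X ++ Y                                ∎
        where open ≡-Reasoning
      mr⊆X : (m ∷ r ∷ []) ⊆ X
      mr⊆X = subst₂ (λ a b → (a ∷ b ∷ []) ⊆ X) π₁≡m orbit-s (pair-⊆-applyUpTo orbit 1<s (n<1+n s))
      2j⊆Y : (2 ∷ j ∷ []) ⊆ Y
      2j⊆Y = subst₂ (λ a b → (a ∷ b ∷ []) ⊆ Y)
        (trans (cong orbit (+-identityʳ (suc s))) orbit-ss)
        (trans (cong orbit (m+[n∸m]≡n (<⇒≤ ss<m₁))) orbit-m₁)
        (pair-⊆-applyUpTo (orbit ∘ (suc s +_)) (m<n⇒0<n∸m ss<m₁) (∸-monoʳ-< (n<1+n s) (<⇒≤ ss<m₁)))

    one-before-two : 3 ≤ m → (1 ∷ 2 ∷ []) ⊆ π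
    one-before-two 3≤m with U , V , π≡ ← ∈-∃++ (complete (s≤s z≤n) (s≤s z≤n))
      with ∈-++⁻ U (subst (2 ∈_) π≡ (complete (s≤s z≤n) (<⇒≤ 3≤m)))
    ... | inj₂ (there 2∈V) = subst ((1 ∷ 2 ∷ []) ⊆_) (sym π≡) (Sublist.++⁺ˡ U (refl ∷ from∈ 2∈V))
    ... | inj₁ 2∈U
      with r′ , r′< , atU≡2 ← ∈⇒at 2∈U
      with orbit-index {2} (s≤s z≤n) (<⇒≤ 3≤m)
    ... | zero  , _   , ()
    ... | suc s , t<m , orbit-ss = ⊥-elim (no-1342-rotation orbit-s orbit-ss t<m orbit-m₁ 2<r r<j j<m)
      where
      j r : ℕ
      j = suc (length U)
      r = suc r′
      π-at-j : at π j ≡ 1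
      π-at-j = subst (λ l → at l j ≡ 1) (sym π≡) (at-++-length U 1 V)
      π-at-r : at π r ≡ 2
      π-at-r = trans (cong (λ l → at l r) π≡) (trans (at-++ˡ U (1 ∷ V) r′<) atU≡2)
      r<j : r < j
      r<j = s≤s r′<
      j≤m : j ≤ m
      j≤m = subst (j ≤_) (begin
        j + length V                ≡⟨ +-suc (length U) (length V) ⟨
        length U + length (1 ∷ V)   ≡⟨ length-++ U ⟨
        length (U ++ 1 ∷ V)         ≡⟨ cong length π≡ ⟨
        length π                    ≡⟨ length≡ ⟩
        m                           ∎) (m≤m+n j (length V))
        where open ≡-Reasoning
      orbit-m₁ : orbit m₁ ≡ j
      orbit-m₁ = uncurry at-injective-on (orbit-bounded m₁) (s≤s z≤n) j≤m
                                         (trans orbit-period (sym π-at-j))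
      orbit-s : orbit s ≡ r
      orbit-s = uncurry at-injective-on (orbit-bounded s) (s≤s z≤n) (<⇒≤ (<-≤-trans r<j j≤m))
                                        (trans orbit-ss (sym π-at-r))
      1<r : 1 < r
      1<r = ≤∧≢⇒< (s≤s z≤n) λ 1≡r →
        <⇒≢ 3≤m (sym (trans (sym π₁≡m) (subst (λ x → at π x ≡ 2) (sym 1≡r) π-at-r)))
      2<r : 2 < r
      2<r = ≤∧≢⇒< 1<r λ 2≡r →
        orbit-distinct (n<1+n s) t<m (trans orbit-s (trans (sym 2≡r) (sym orbit-ss)))
      j<m : j < m
      j<m = ≤∧≢⇒< j≤m λ j≡m → <⇒≢ (≤-pred 3≤m) (sym (orbit-injective (n<1+n m₁) (≤-trans (n≤1+n 2) 3≤m)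
                                                      (trans orbit-m₁ (trans j≡m (sym π₁≡m)))))

-- Inserting a new maximum into the cycle

swap₁ : ℕ → ℕ → ℕ
swap₁ n x with x ≟ 1 | x ≟ n
... | yes _ | _     = n
... | no  _ | yes _ = 1
... | no  _ | no  _ = x

swap₁-fix : ∀ {n x} → x ≢ 1 → x ≢ n → swap₁ n x ≡ x
swap₁-fix {n} {x} x≢1 x≢n with x ≟ 1 | x ≟ n
... | yes x≡1 | _       = contradiction x≡1 x≢1
... | no  _   | yes x≡n = contradiction x≡n x≢n
... | no  _   | no  _   = refl

swap₁-involutive : ∀ {n} → 2 ≤ n → ∀ x → swap₁ n (swap₁ n x) ≡ x
swap₁-involutive {n} 2≤n x with x ≟ 1 | x ≟ n
... | yes refl | _        = swap₁-n
  where
  swap₁-n : swap₁ n n ≡ 1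
  swap₁-n with n ≟ 1 | n ≟ n
  ... | yes refl | _       = contradiction 2≤n (λ { (s≤s ()) })
  ... | no  _    | yes _   = refl
  ... | no  _    | no  n≢n = contradiction refl n≢n
... | no  _    | yes refl = refl
... | no  x≢1  | no  x≢n  = swap₁-fix x≢1 x≢n

swap₁-injective : ∀ {n} → 2 ≤ n → ∀ {x y} → swap₁ n x ≡ swap₁ n y → x ≡ y
swap₁-injective 2≤n {x} {y} eq =
  trans (sym (swap₁-involutive 2≤n x)) (trans (cong (swap₁ _) eq) (swap₁-involutive 2≤n y))

-- Inserts n into the cycle of π right before 1, so that C(extendCycle n π) =
-- C(π) ++ [n]; the first entry stays and the new last entry is 1.
extendCycle : ℕ → List ℕ → List ℕ
extendCycle n π = map (swap₁ n) π ++ [ 1 ]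

extendCycle-injective : ∀ {n} → 2 ≤ n → ∀ {π π′} →
                        extendCycle n π ≡ extendCycle n π′ → π ≡ π′
extendCycle-injective 2≤n {π} {π′} eq =
  map-injective (swap₁-injective 2≤n) (proj₁ (∷ʳ-injective (map _ π) (map _ π′) eq))

module ExtendCycle {m₁ π} (perm : IsPerm (suc m₁) π) (1≤m₁ : 1 ≤ m₁) where

  open IsPerm perm

  m n : ℕ
  m = suc m₁
  n = suc m

  g : ℕ → ℕ
  g = swap₁ n

  σ : List ℕ
  σ = extendCycle n π

  g-involutive : ∀ x → g (g x) ≡ x
  g-involutive = swap₁-involutive (s≤s (s≤s z≤n))

  g-injective : ∀ {x y} → g x ≡ g y → x ≡ y
  g-injective = swap₁-injective (s≤s (s≤s z≤n))

  g-fix : ∀ {y} → 1 < y → y ≤ m → g y ≡ y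
  g-fix 1<y y≤m = swap₁-fix (>⇒≢ 1<y) (<⇒≢ (s≤s y≤m))

  g-≢1 : ∀ {y} → y ≤ m → g y ≢ 1
  g-≢1 {y} y≤m gy≡1 = <⇒≢ (s≤s y≤m) (trans (sym (g-involutive y)) (cong g gy≡1))

  g-bounded : ∀ {y} → 1 ≤ y → y ≤ m → 1 < g y × g y ≤ n
  g-bounded {1}           _ _   = s≤s (s≤s z≤n) , ≤-refl
  g-bounded {suc (suc y)} _ y≤m rewrite g-fix (s≤s (s≤s z≤n)) y≤m =
    s≤s (s≤s z≤n) , m≤n⇒m≤1+n y≤m

  length-map-g : length (map g π) ≡ m
  length-map-g = trans (length-map g π) length≡

  isPerm : IsPerm n σ
  isPerm = record
    { length≡ = trans (length-++ (map g π)) (trans (+-comm (length (map g π)) 1) (cong suc length-map-g))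
    ; bounded = bnd
    ; unique  = Unique.++⁺ (Unique.map⁺ g-injective unique) ([] ∷ [])
                           λ { (1∈ , here refl) → new-1 1∈ }
    }
    where
    new-1 : 1 ∉ map g π
    new-1 1∈ with y , y∈ , 1≡gy ← ∈-map⁻ g 1∈ = g-≢1 (proj₂ (bounded y∈)) (sym 1≡gy)
    bnd : ∀ {z} → z ∈ σ → 1 ≤ z × z ≤ n
    bnd z∈ with ∈-++⁻ (map g π) z∈
    ... | inj₂ (here refl) = s≤s z≤n , s≤s z≤n
    ... | inj₁ z∈map with y , y∈ , refl ← ∈-map⁻ g z∈map =
      let 1<gy , gy≤n = uncurry g-bounded (bounded y∈) in <⇒≤ 1<gy , gy≤n

  at-σ : ∀ {x} → 1 ≤ x → x ≤ m → at σ x ≡ g (at π x)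
  at-σ {suc i} _ i<m = trans (at-++ˡ (map g π) [ 1 ] (subst (i <_) (sym length-map-g) i<m))
                             (at-map g π (subst (i <_) (sym length≡) i<m))

  at-σ-last : at σ n ≡ 1
  at-σ-last = subst (λ l → at σ (suc l) ≡ 1) length-map-g (at-++-length (map g π) 1 [])

  at-σ-first : at π 1 ≡ m → at σ 1 ≡ m
  at-σ-first π₁≡m = begin
    at σ 1     ≡⟨ at-σ (s≤s z≤n) (s≤s z≤n) ⟩
    g (at π 1) ≡⟨ cong g π₁≡m ⟩
    g m        ≡⟨ g-fix (s≤s 1≤m₁) ≤-refl ⟩
    m          ∎
    where open ≡-Reasoning

  iter-π-bounded : ∀ t → 1 ≤ iter π t 1 × iter π t 1 ≤ m
  iter-π-bounded = iter-bounded (s≤s z≤n)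

  NoReturnBefore : ℕ → Set
  NoReturnBefore t = ∀ {s} → s < t → iter π (suc s) 1 ≢ 1

  iter-σ : ∀ t → NoReturnBefore t → iter σ t 1 ≡ iter π t 1
  iter-σ zero    _  = refl
  iter-σ (suc t) nr = begin
    at σ (iter σ t 1)    ≡⟨ cong (at σ) (iter-σ t (nr ∘ m<n⇒m<1+n)) ⟩
    at σ (iter π t 1)    ≡⟨ uncurry at-σ (iter-π-bounded t) ⟩
    g (iter π (suc t) 1) ≡⟨ g-fix 1<πt πt≤m ⟩
    iter π (suc t) 1     ∎
    where
    open ≡-Reasoning
    1<πt : 1 < iter π (suc t) 1
    1<πt = ≤∧≢⇒< (proj₁ (iter-π-bounded (suc t))) (≢-sym (nr (n<1+n t)))
    πt≤m : iter π (suc t) 1 ≤ m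
    πt≤m = proj₂ (iter-π-bounded (suc t))

  iter-σ-suc : ∀ t → NoReturnBefore t → iter σ (suc t) 1 ≡ g (iter π (suc t) 1)
  iter-σ-suc t nr = trans (cong (at σ) (iter-σ t nr)) (uncurry at-σ (iter-π-bounded t))

  length-σ∸1 : length σ ∸ 1 ≡ m
  length-σ∸1 = cong (_∸ 1) (IsPerm.length≡ isPerm)

  -- A return of π to 1 after t + 1 < m steps would make σ pass 1 → n → 1.
  cyclic⇔ : Cyclic σ ⇔ Cyclic π
  cyclic⇔ = mk⇔ shrink extend
    where
    shrink : Cyclic σ → Cyclic π
    shrink cycσ {i} i< = no-return (suc i) (subst (i <_) (cong (_∸ 1) length≡) i<) (n<1+n i)
      where
      no-return : ∀ t → t ≤ m₁ → NoReturnBefore t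
      no-return zero    _ ()
      no-return (suc t) t<m₁ {s} s<st with m<1+n⇒m<n∨m≡n s<st
      ... | inj₁ s<t  = no-return t (<⇒≤ t<m₁) s<t
      ... | inj₂ refl = λ back → cycσ (subst (suc s <_) (sym length-σ∸1) (s≤s t<m₁)) (begin
        at σ (iter σ (suc s) 1)  ≡⟨ cong (at σ) (iter-σ-suc s (no-return s (<⇒≤ t<m₁))) ⟩
        at σ (g (iter π (suc s) 1)) ≡⟨ cong (at σ ∘ g) back ⟩
        at σ n                   ≡⟨ at-σ-last ⟩
        1                        ∎)
        where open ≡-Reasoning
    extend : Cyclic π → Cyclic σ
    extend cycπ {i} i< eq = g-≢1 (proj₂ (iter-π-bounded (suc i))) (trans (sym (iter-σ-suc i nr)) eq)
      where
      nr : NoReturnBefore i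
      nr s<i = cycπ (subst (_ <_) (sym (cong (_∸ 1) length≡))
                           (<-≤-trans s<i (≤-pred (subst (i <_) length-σ∸1 i<))))

  cycleForm-σ : Cyclic π → cycleForm σ ≡ cycleForm π ++ [ n ]
  cycleForm-σ cycπ = begin
    applyUpTo orbitσ (length σ)         ≡⟨ cong (applyUpTo orbitσ) (IsPerm.length≡ isPerm) ⟩
    applyUpTo orbitσ (suc m)            ≡⟨ applyUpTo-∷ʳ orbitσ m ⟨
    applyUpTo orbitσ m ++ [ orbitσ m ]  ≡⟨ cong₂ (λ xs x → xs ++ [ x ]) (applyUpTo-cong m agree) last ⟩
    applyUpTo orbit m ++ [ n ]          ≡⟨ cong (_++ [ n ]) cycleForm≡ ⟨
    cycleForm π ++ [ n ]                ∎
    where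
    open ≡-Reasoning
    open CyclicPerm perm cycπ using (orbit; orbit-no-return; orbit-period; cycleForm≡)
    nr : ∀ {t} → t ≤ m₁ → NoReturnBefore t
    nr t≤m₁ s<t = orbit-no-return (<-≤-trans s<t t≤m₁)
    orbitσ : ℕ → ℕ
    orbitσ t = iter σ t 1
    agree : ∀ {i} → i < m → orbitσ i ≡ orbit i
    agree i<m = iter-σ _ (nr (≤-pred i<m))
    last : orbitσ m ≡ n
    last = trans (iter-σ-suc m₁ (nr ≤-refl)) (cong g orbit-period)

  HasDecreasing-σ⇔ : ∀ {k} → HasDecreasing (suc k) σ ⇔ HasDecreasing k (map g π)
  HasDecreasing-σ⇔ = HasDecreasing-∷ʳ-min above-1
    where
    above-1 : ∀ {z} → z ∈ map g π → 1 < z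
    above-1 z∈ with y , y∈ , refl ← ∈-map⁻ g z∈ = proj₁ (uncurry g-bounded (bounded y∈))

  fixed-after : ∀ {z t₀} → z ∷ t₀ ⊆ π → Decreasing (g z ∷ map g t₀) → map g t₀ ≡ t₀
  fixed-after {z} {t₀} zt₀⊆π (gz> ∷ _) = map-id-local (All.tabulate fixes)
    where
    fixes : ∀ {w} → w ∈ t₀ → g w ≡ w
    fixes {zero}        w∈ = contradiction (proj₁ (bounded (lookup zt₀⊆π (there w∈)))) λ ()
    fixes {1}           w∈ = contradiction (All.lookup gz> (∈-map⁺ g w∈)) (≤⇒≯ gz≤n)
      where
      gz≤n : g z ≤ n
      gz≤n = proj₂ (uncurry g-bounded (bounded (lookup zt₀⊆π (here refl))))
    fixes {suc (suc w)} w∈ = g-fix (s≤s (s≤s z≤n)) (proj₂ (bounded (lookup zt₀⊆π (there w∈))))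

  -- A decreasing subsequence of map g π through n = g 1 starts there; since
  -- π starts with m, replacing that n by m gives one of π.
  HasDecreasing-unswap : ∀ {k} → at π 1 ≡ m → HasDecreasing k (map g π) → HasDecreasing k π
  HasDecreasing-unswap π₁≡m (t , t⊆ , dec , len) with ⊆-map⁻ g π t⊆
  ... | [] , _ , refl = [] , minimum π , [] , len
  ... | z ∷ t₀ , zt₀⊆π , refl with fixed-after zt₀⊆π dec | z ≟ 1
  ...   | fixed | no z≢1 =
    z ∷ t₀ , zt₀⊆π , subst Decreasing gzt₀≡ dec , trans (cong length (sym gzt₀≡)) len
    where
    gzt₀≡ : g z ∷ map g t₀ ≡ z ∷ t₀
    gzt₀≡ = cong₂ _∷_ (g-fix (≤∧≢⇒< (proj₁ z-bounds) (≢-sym z≢1)) (proj₂ z-bounds)) fixed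
      where
      z-bounds : 1 ≤ z × z ≤ m
      z-bounds = bounded (lookup zt₀⊆π (here refl))
  ...   | fixed | yes refl with rest , π≡ ← head-view π (subst (0 <_) (sym length≡) z<s) =
    m ∷ t₀ , subst (m ∷ t₀ ⊆_) (sym π≡′) (refl ∷ t₀⊆rest) ,
    All.tabulate below-m ∷ subst Decreasing fixed (proj₂ (uncons dec)) ,
    trans (cong (suc ∘ length) (sym fixed)) len
    where
    π≡′ : π ≡ m ∷ rest
    π≡′ = trans π≡ (cong (_∷ rest) π₁≡m)
    t₀⊆rest : t₀ ⊆ rest
    t₀⊆rest with subst (1 ∷ t₀ ⊆_) π≡′ zt₀⊆π
    ... | _ ∷ʳ 1t₀⊆rest = Sublist.∷ˡ⁻ 1t₀⊆rest
    ... | 1≡m ∷ _       = contradiction 1≡m (<⇒≢ (s≤s 1≤m₁))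
    below-m : ∀ {w} → w ∈ t₀ → m > w
    below-m w∈ with m≢rest ∷ _ ← subst Unique π≡′ unique =
      ≤∧≢⇒< (proj₂ (bounded (subst (_ ∈_) (sym π≡′) (there (lookup t₀⊆rest w∈)))))
            (≢-sym (All.lookup m≢rest (lookup t₀⊆rest w∈)))

  HasDecreasing-lift : ∀ {t} → t ⊆ π → Decreasing t → All (1 <_) t →
                       HasDecreasing (length t) (map g π)
  HasDecreasing-lift {t} t⊆π dec 1<t = t , subst (_⊆ map g π) fixed (Sublist.map⁺ g t⊆π) , dec , refl
    where
    fixed : map g t ≡ t
    fixed = map-id-local (All.tabulate λ w∈ →
      g-fix (All.lookup 1<t w∈) (proj₂ (bounded (lookup t⊆π w∈))))

  -- A decreasing subsequence of π ending in 1 may end in 2 instead, as 1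
  -- precedes 2 in π; this is where k ≥ 3 and the 1342 condition enter.
  HasDecreasing-swap : ∀ {k} → at π 1 ≡ m → Cyclic π → CyclicallyAvoids1342 (cycleForm π) →
                       3 ≤ k → HasDecreasing k π → HasDecreasing k (map g π)
  HasDecreasing-swap π₁≡m cyc avoid 3≤k (t , t⊆π , dec , refl) with initLast t
  ... | []       = [] , minimum _ , [] , refl
  ... | t₀ ∷ʳ′ x with x ≟ 1
  ...   | no x≢1 =
    HasDecreasing-lift t⊆π dec (All-++⁺ (All.map (<-trans 1<x) (Decreasing-∷ʳ-above t₀ dec)) (1<x ∷ []))
    where
    1<x : 1 < x
    1<x = ≤∧≢⇒< (proj₁ (bounded (lookup t⊆π (∈-++⁺ʳ t₀ (here refl))))) (≢-sym x≢1)
  ...   | yes refl =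
    subst (λ l → HasDecreasing l (map g π)) (trans (length-++ t₀) (sym (length-++ t₀)))
      (HasDecreasing-lift t₀2⊆π
        (AllPairs.++⁺ (Decreasing-++⁻ˡ t₀ dec) ([] ∷ []) (All.map (_∷ []) 2<t₀))
        (All-++⁺ (All.map (<-trans (s≤s (s≤s z≤n))) 2<t₀) (s≤s (s≤s z≤n) ∷ [])))
    where
    3≤m : 3 ≤ m
    3≤m = ≤-trans 3≤k (≤-trans (Sublist.length-mono-≤ t⊆π) (≤-reflexive length≡))
    t₀2⊆π : t₀ ++ [ 2 ] ⊆ π
    t₀2⊆π = ⊆-∷ʳ-replace unique t⊆π (CyclicPerm.one-before-two perm cyc π₁≡m avoid 3≤m)
    2<t₀ : All (2 <_) t₀
    2<t₀ = All.tabulate λ w∈ →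
      ≤∧≢⇒< (All.lookup (Decreasing-∷ʳ-above t₀ dec) w∈)
            (≢-sym (Unique-++-disjoint (Unique-resp-⊇ t₀2⊆π unique) w∈ (here refl)))

  inA⇔ : ∀ {k} → at π 1 ≡ m → 3 ≤ k → InA (suc k) σ ⇔ InA k π
  inA⇔ {k} π₁≡m 3≤k = mk⇔ shrink extend
    where
    avoid⇔ : Cyclic π → CyclicallyAvoids1342 (cycleForm σ) ⇔ CyclicallyAvoids1342 (cycleForm π)
    avoid⇔ cyc = subst (λ C → CyclicallyAvoids1342 C ⇔ CyclicallyAvoids1342 (cycleForm π))
                       (sym (cycleForm-σ cyc))
                       (CyclicallyAvoids1342-∷ʳ cycleForm-isPerm (proj₂ (cycleForm-shape π₁≡m 1≤m₁))
                                                (n<1+n m))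
      where open CyclicPerm perm cyc using (cycleForm-isPerm; cycleForm-shape)
    shrink : InA (suc k) σ → InA k π
    shrink (cycσ , no-dec , avoidσ) =
      cycπ , no-dec ∘ from HasDecreasing-σ⇔ ∘ HasDecreasing-swap π₁≡m cycπ avoidπ 3≤k , avoidπ
      where
      cycπ : Cyclic π
      cycπ = to cyclic⇔ cycσ
      avoidπ : CyclicallyAvoids1342 (cycleForm π)
      avoidπ = to (avoid⇔ cycπ) avoidσ
    extend : InA k π → InA (suc k) σ
    extend (cycπ , no-dec , avoidπ) =
      from cyclic⇔ cycπ , no-dec ∘ HasDecreasing-unswap π₁≡m ∘ to HasDecreasing-σ⇔ ,
      from (avoid⇔ cycπ) avoidπ

-- Counting

counted-c° : ℕ → ℕ → List (List ℕ)
counted-c° n k = filterᵇ (λ π → inA k π ∧ (first π ≡ᵇ (n ∸ 1)) ∧ (lastE π ≡ᵇ 1)) (perms n)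

counted-b° : ℕ → ℕ → List (List ℕ)
counted-b° m k = filterᵇ (λ π → inA k π ∧ (first π ≡ᵇ m)) (perms m)

InC° : ℕ → ℕ → List ℕ → Set
InC° n k σ = IsPerm n σ × InA k σ × at σ 1 ≡ n ∸ 1 × at σ n ≡ 1

InB° : ℕ → ℕ → List ℕ → Set
InB° m k π = IsPerm m π × InA k π × at π 1 ≡ m

∈-counted-c°⇔ : ∀ {n k σ} → σ ∈ counted-c° n k ⇔ InC° n k σ
∈-counted-c°⇔ {n} {k} {σ} = mk⇔ counted count
  where
  counted : σ ∈ counted-c° n k → InC° n k σ
  counted σ∈ with σ∈perms , t ← to ∈-filterᵇ⇔ σ∈ with a , rest ← to (T-∧ {inA k σ}) t
    with f , l ← to (T-∧ {first σ ≡ᵇ (n ∸ 1)}) rest with perm ← to ∈-perms⇔ σ∈perms =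
    perm , to T-inA⇔ a , ≡ᵇ⇒≡ _ _ f ,
    subst (λ i → at σ i ≡ 1) (IsPerm.length≡ perm) (≡ᵇ⇒≡ _ _ l)
  count : InC° n k σ → σ ∈ counted-c° n k
  count (perm , a , f , l) = from ∈-filterᵇ⇔ (from ∈-perms⇔ perm ,
    from (T-∧ {inA k σ}) (from T-inA⇔ a , from T-∧ (≡⇒≡ᵇ _ _ f , ≡⇒≡ᵇ _ _ last)))
    where
    last : lastE σ ≡ 1
    last = subst (λ i → at σ i ≡ 1) (sym (IsPerm.length≡ perm)) l

∈-counted-b°⇔ : ∀ {m k π} → π ∈ counted-b° m k ⇔ InB° m k π
∈-counted-b°⇔ {m} {k} {π} = mk⇔ counted count
  where
  counted : π ∈ counted-b° m k → InB° m k π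
  counted π∈ with π∈perms , t ← to ∈-filterᵇ⇔ π∈ with a , f ← to (T-∧ {inA k π}) t =
    to ∈-perms⇔ π∈perms , to T-inA⇔ a , ≡ᵇ⇒≡ _ _ f
  count : InB° m k π → π ∈ counted-b° m k
  count (perm , a , f) =
    from ∈-filterᵇ⇔ (from ∈-perms⇔ perm , from (T-∧ {inA k π}) (from T-inA⇔ a , ≡⇒≡ᵇ _ _ f))

InC°⇔extendCycle : ∀ {m₁ k σ} → 1 ≤ m₁ → 3 ≤ k →
                   InC° (suc (suc m₁)) (suc k) σ ⇔
                   ∃ λ π → InB° (suc m₁) k π × σ ≡ extendCycle (suc (suc m₁)) π
InC°⇔extendCycle {m₁} {k} {σ} 1≤m₁ 3≤k = mk⇔ restrict extend
  where
  m n : ℕ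
  m = suc m₁
  n = suc m
  2≤n : 2 ≤ n
  2≤n = s≤s (s≤s z≤n)
  extend : (∃ λ π → InB° m k π × σ ≡ extendCycle n π) → InC° n (suc k) σ
  extend (π , (perm , a , π₁≡m) , refl) =
    isPerm , from (inA⇔ π₁≡m 3≤k) a , at-σ-first π₁≡m , at-σ-last
    where open ExtendCycle perm 1≤m₁
  restrict : InC° n (suc k) σ → ∃ λ π → InB° m k π × σ ≡ extendCycle n π
  restrict (perm , a , σ₁≡m , σₙ≡1) with initLast σ
  ... | []      = contradiction (IsPerm.length≡ perm) λ ()
  ... | U ∷ʳ′ x = π , (permπ , to (inA⇔ π₁≡m 3≤k) (subst (InA (suc k)) σ≡ a) , π₁≡m) , σ≡
    where
    open IsPerm perm
    π : List ℕ
    π = map (swap₁ n) U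
    length-U : length U ≡ m
    length-U = suc-injective (trans (trans (+-comm 1 (length U)) (sym (length-++ U))) length≡)
    x≡1 : x ≡ 1
    x≡1 = trans (sym (at-++-length U x []))
                (subst (λ i → at (U ++ [ x ]) (suc i) ≡ 1) (sym length-U) σₙ≡1)
    σ≡ : U ++ [ x ] ≡ extendCycle n π
    σ≡ = cong₂ _++_ (sym (map-involutive (swap₁-involutive 2≤n) U)) (cong [_] x≡1)
    in-U : ∀ {y} → y ∈ U → 1 < y × y ≤ n
    in-U y∈ = ≤∧≢⇒< (proj₁ (bounded (∈-++⁺ˡ y∈)))
                    (λ 1≡y → Unique-++-disjoint unique y∈ (here refl) (trans (sym 1≡y) (sym x≡1)))
            , proj₂ (bounded (∈-++⁺ˡ y∈))
    bounded-π : ∀ {z} → z ∈ π → 1 ≤ z × z ≤ m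
    bounded-π z∈ with y , y∈ , refl ← ∈-map⁻ (swap₁ n) z∈ with in-U y∈
    ... | 1<y , y≤n with m≤n⇒m<n∨m≡n y≤n
    ...   | inj₁ y<n  rewrite swap₁-fix (>⇒≢ 1<y) (<⇒≢ y<n) = <⇒≤ 1<y , ≤-pred y<n
    ...   | inj₂ refl rewrite swap₁-involutive 2≤n 1 = ≤-refl , s≤s z≤n
    permπ : IsPerm m π
    permπ = record
      { length≡ = trans (length-map (swap₁ n) U) length-U
      ; bounded = bounded-π
      ; unique  = Unique.map⁺ (swap₁-injective 2≤n)
                              (Unique-resp-⊇ (Sublist.++⁺ʳ [ x ] ⊆-refl) unique)
      }
    π₁≡m : at π 1 ≡ m
    π₁≡m = begin
      at π 1                        ≡⟨ at-map (swap₁ n) U U-nonempty ⟩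
      swap₁ n (at U 1)              ≡⟨ cong (swap₁ n) (at-++ˡ U [ x ] U-nonempty) ⟨
      swap₁ n (at (U ++ [ x ]) 1)   ≡⟨ cong (swap₁ n) σ₁≡m ⟩
      swap₁ n m                     ≡⟨ swap₁-fix (>⇒≢ (s≤s 1≤m₁)) (<⇒≢ (n<1+n m)) ⟩
      m                             ∎
      where
      open ≡-Reasoning
      U-nonempty : 0 < length U
      U-nonempty = subst (0 <_) (sym length-U) z<s
    open ExtendCycle permπ 1≤m₁ using (inA⇔)

∈-counted-c°⇔∈-image : ∀ {m₁ k σ} → 1 ≤ m₁ → 3 ≤ k →
                       σ ∈ counted-c° (suc (suc m₁)) (suc k) ⇔
                       σ ∈ map (extendCycle (suc (suc m₁))) (counted-b° (suc m₁) k)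
∈-counted-c°⇔∈-image {m₁} {k} {σ} 1≤m₁ 3≤k = mk⇔ image preimage
  where
  n : ℕ
  n = suc (suc m₁)
  image : σ ∈ counted-c° n (suc k) → σ ∈ map (extendCycle n) (counted-b° (suc m₁) k)
  image σ∈ with π , inB , refl ← to (InC°⇔extendCycle 1≤m₁ 3≤k) (to ∈-counted-c°⇔ σ∈) =
    ∈-map⁺ (extendCycle n) (from ∈-counted-b°⇔ inB)
  preimage : σ ∈ map (extendCycle n) (counted-b° (suc m₁) k) → σ ∈ counted-c° n (suc k)
  preimage σ∈ with π , π∈ , σ≡ ← ∈-map⁻ (extendCycle n) σ∈ =
    from ∈-counted-c°⇔ (from (InC°⇔extendCycle 1≤m₁ 3≤k) (π , to ∈-counted-b°⇔ π∈ , σ≡))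

lemma3p5 : (n k : ℕ) → 3 ≤ n → 4 ≤ k → c° n k ≡ b° (n ∸ 1) (k ∸ 1)
lemma3p5 .(suc (suc m₁)) .(suc k) (s≤s (s≤s {n = m₁} 1≤m₁)) (s≤s {n = k} 3≤k) = begin
  c° n (suc k)                                   ≡⟨⟩
  length (counted-c° n (suc k))                  ≡⟨ unique∧set⇒length≡ unique-c° unique-image same ⟩
  length (map (extendCycle n) (counted-b° m k))  ≡⟨ length-map (extendCycle n) (counted-b° m k) ⟩
  length (counted-b° m k)                        ≡⟨⟩
  b° m k                                         ∎
  where
  open ≡-Reasoning
  m n : ℕ
  m = suc m₁
  n = suc m
  unique-c° : Unique (counted-c° n (suc k))
  unique-c° = Unique.filter⁺ _ (Unique-perms n)
  same : ∀ {σ} → σ ∈ counted-c° n (suc k) ⇔ σ ∈ map (extendCycle n) (counted-b° m k)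
  same = ∈-counted-c°⇔∈-image 1≤m₁ 3≤k
  unique-image : Unique (map (extendCycle n) (counted-b° m k))
  unique-image = Unique.map⁺ (extendCycle-injective (s≤s (s≤s z≤n)))
                             (Unique.filter⁺ _ (Unique-perms m))
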